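{- Let $G$ be a simple graph on the vertex set $[n]$ (with its natural order), and let $\mathrm{Mill}(G)$ be the set of sequences $(L_1,\dots,L_r)$ of nonempty, pairwise disjoint independent sets of $G$ whose union is $[n]$. Let $\varphi:\mathrm{Mill}(G)\to\mathrm{Mill}(G)$ be the left-right map defined below. Then $\varphi$ is an involution, i.e. $\varphi(\varphi(L))=L$ for all $L\in\mathrm{Mill}(G)$.
   Context: For $L=(L_1,\dots,L_r)\in\mathrm{Mill}(G)$ and $c\in L_i$, let $j\le i$ be minimal such that no element of $L_j\cup\cdots\cup L_{i-1}$ is adjacent to $c$ in $G$; the disconnected region of $c$ is $\mathrm{DR}_c=L_j\cup\dots\cup L_{i-1}$ (empty if $j=i$), and $m_c=\min \mathrm{DR}_c$, or $m_c=\infty$ if $\mathrm{DR}_c=\emptyset$. A block $L_i$ is bad if $|L_i|\ge 2$, or if $L_i=\{c\}$ with $m_c<c$. Define $\varphi(L)$: if no block is bad, $\varphi(L)=L$. Otherwise let $L_i$ be the leftmost bad block, with elements $c_1<\dots<c_k$. Merge case: if $m_{c_a}<c_a$ for all $a$, then $\varphi(L)$ is obtained by replacing the two consecutive blocks $L_{i-1},L_i$ by the single block $L_{i-1}\cup L_i$ (in this case $i\ge 2$, $L_{i-1}$ is a singleton, and the result lies in $\mathrm{Mill}(G)$, so this is well defined). Split case: otherwise, let $a$ be the smallest index with $m_{c_a}>c_a$, and $\varphi(L)$ is obtained by replacing the block $L_i$ by the two consecutive blocks $\{c_a\}, L_i\smallsetminus\{c_a\}$ in that order. (In the paper $G=\Gamma\smallsetminus\{P,Q\}$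 and elements of $\mathrm{Mill}(G)$ are called $\Gamma$-millipedes.) -}

module Defs where

open import Data.Nat using (ℕ; zero; suc; _<ᵇ_)
open import Data.Bool using (Bool; true; false; _∨_; _∧_; not; if_then_else_)
open import Data.Fin using (Fin; zero; suc; toℕ)
open import Data.Fin.Subset using (Subset; Side; inside; outside; ⊥; ⁅_⁆; _∪_; _-_; _∈_; Nonempty; Empty; _∩_)
open import Data.Vec using (Vec; []; _∷_; lookup)
open import Data.List using (List; []; _∷_; reverse; _++_)
open import Data.List.Relation.Unary.All using (All)
open import Data.List.Relation.Unary.Any using (Any)
open import Data.List.Relation.Unary.AllPairs using (AllPairs)
open import Data.Maybe using (Maybe; just; nothing)
open import Relation.Binary.PropositionalEquality using (_≡_)

record SimpleGraph (n : ℕ) : Set where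
  field
    adj    : Fin n → Fin n → Bool
    sym    : ∀ u v → adj u v ≡ adj v u
    irrefl : ∀ v → adj v v ≡ false
open SimpleGraph public

Independent : ∀ {n} → SimpleGraph n → Subset n → Set
Independent G B = ∀ u v → u ∈ B → v ∈ B → adj G u v ≡ false

Disjoint : ∀ {n} → Subset n → Subset n → Set
Disjoint A B = Empty (A ∩ B)

IsMill : ∀ {n} → SimpleGraph n → List (Subset n) → Set
IsMill {n} G L =
  All Nonempty L × All (Independent G) L × AllPairs Disjoint L
  × (∀ (x : Fin n) → Any (x ∈_) L)
  where open import Data.Product using (_×_)

isIn : ∀ {n} → Fin n → Subset n → Bool
isIn c p with lookup p c
... | inside  = true
... | outside = false

anyFin : ∀ {n} → (Fin n → Bool) → Bool
anyFin {zero}  f = false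
anyFin {suc n} f = f zero ∨ anyFin (λ i → f (suc i))

allFinB : ∀ {n} → (Fin n → Bool) → Bool
allFinB f = not (anyFin (λ i → not (f i)))

elems : ∀ {n} → Subset n → List (Fin n)
elems {zero}  []            = []
elems {suc n} (inside ∷ p)  = zero ∷ Data.List.map suc (elems p)
elems {suc n} (outside ∷ p) = Data.List.map suc (elems p)

-- minimum of a subset (nothing = ∞ for the empty set)
minS : ∀ {n} → Subset n → Maybe (Fin n)
minS {zero}  []            = nothing
minS {suc n} (inside ∷ p)  = just zero
minS {suc n} (outside ∷ p) = Data.Maybe.map suc (minS p)

hasNbr : ∀ {n} → SimpleGraph n → Fin n → Subset n → Bool
hasNbr G c B = anyFin (λ v → isIn v B ∧ adj G c v)

takeWhileᵇ : ∀ {A : Set} → (A → Bool) → List A → List A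
takeWhileᵇ p []       = []
takeWhileᵇ p (x ∷ xs) = if p x then x ∷ takeWhileᵇ p xs else []

unions : ∀ {n} → List (Subset n) → Subset n
unions []       = ⊥
unions (B ∷ Bs) = B ∪ unions Bs

-- Disconnected region of c.  `pre` is the list of blocks to the left of
-- the block of c, nearest first: pre = L_{i-1} ∷ L_{i-2} ∷ … ∷ L_1.
DR : ∀ {n} → SimpleGraph n → Fin n → List (Subset n) → Subset n
DR G c pre = unions (takeWhileᵇ (λ B → not (hasNbr G c B)) pre)

mc : ∀ {n} → SimpleGraph n → Fin n → List (Subset n) → Maybe (Fin n)
mc G c pre = minS (DR G c pre)

mLess : ∀ {n} → Maybe (Fin n) → Fin n → Bool
mLess nothing  c = false
mLess (just m) c = toℕ m <ᵇ toℕ c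

mGreater : ∀ {n} → Maybe (Fin n) → Fin n → Bool
mGreater nothing  c = true
mGreater (just m) c = toℕ c <ᵇ toℕ m

allB : ∀ {A : Set} → (A → Bool) → List A → Bool
allB p []       = true
allB p (x ∷ xs) = p x ∧ allB p xs

firstWith : ∀ {A : Set} → (A → Bool) → List A → Maybe A
firstWith p []       = nothing
firstWith p (x ∷ xs) = if p x then just x else firstWith p xs

isBad : ∀ {n} → SimpleGraph n → List (Subset n) → Subset n → Bool
isBad G pre B with elems B
... | []          = false
... | c ∷ []      = mLess (mc G c pre) c
... | _ ∷ _ ∷ _   = true

-- At the leftmost bad block perform the merge or split; the degenerate
-- branches (which cannot occur on Mill(G)) return the input unchanged.
φ-go : ∀ {n} → SimpleGraph n → List (Subset n) → List (Subset n) → List (Subset n)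
φ-go G pre [] = reverse pre
φ-go G pre (B ∷ rest) with isBad G pre B
... | false = φ-go G (B ∷ pre) rest
... | true with allB (λ c → mLess (mc G c pre) c) (elems B)
...   | true with pre
...     | []       = reverse pre ++ (B ∷ rest)
...     | P ∷ pre' = reverse pre' ++ ((P ∪ B) ∷ rest)
φ-go G pre (B ∷ rest) | true | false
        with firstWith (λ c → mGreater (mc G c pre) c) (elems B)
... | nothing = reverse pre ++ (B ∷ rest)
... | just c  = reverse pre ++ (⁅ c ⁆ ∷ (B - c) ∷ rest)

φ : ∀ {n} → SimpleGraph n → List (Subset n) → List (Subset n)
φ G L = φ-go G [] L

-- φ scans the blocks from the left, and the blocks it passes are exactly the good
-- ones, so on φ L the scan passes the same prefix again and first stops where φ acted.
-- Split case: {c} is good because m_c > c, and every d of B ∖ {c} now sees c in its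
-- disconnected region (B is independent); if d < c then m_d < d already held, by the
-- minimality of c. So the second scan merges {c} back into B ∖ {c}.
-- Merge case: the good singleton {p} satisfies m_p > p (p lies in no earlier block),
-- while each y ∈ B had m_y < y with p ∈ DR_y; so y < p forces m_y < y already before
-- {p}, and p is the first element of {p} ∪ B with m > itself. The second scan splits p off.
module Submission where

open import Defs hiding (sym)
open import Data.Nat using (ℕ)
open import Data.List using (List)
open import Data.Fin.Subset using (Subset)
open import Relation.Binary.PropositionalEquality using (_≡_)

open import Data.Nat using (zero; suc; _<ᵇ_; _<_; _≤_; z≤n; s≤s)
import Data.Nat.Properties as ℕ
open import Data.Bool using (Bool; true; false; _∨_; _∧_)
open import Data.Bool.Properties using (T-≡; ¬-not; not-¬; ∨-identityʳ)
open import Data.Fin using (Fin; toℕ; _≟_)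
import Data.Fin.Properties as Fin
open import Data.Fin.Subset
  using (Side; inside; outside; ⊥; ⁅_⁆; _∪_; _─_; _-_; _∈_; _∉_; Nonempty)
open import Data.Fin.Subset.Properties
  using (x∈⁅x⁆; x∈⁅y⁆⇒x≡y; ⊆-antisym; ∉⊥; x∈p∩q⁺; x∈p∩q⁻; x∈p∪q⁺; x∈p∪q⁻;
         x∈p∧x≢y⇒x∈p-y; p─q⊆p)
open import Data.Vec using (_∷_; here; there)
open import Data.List using ([]; _∷_; reverse; _++_; map)
open import Data.List.Properties using (ʳ++-defn; ++-identityʳ)
open import Data.List.Membership.Propositional using () renaming (_∈_ to _∈ˡ_)
open import Data.List.Membership.Propositional.Properties using (∈-map⁺; ∈-map⁻)
open import Data.List.Relation.Unary.Any using (Any; here; there)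
open import Data.List.Relation.Unary.All using (All; []; _∷_)
import Data.List.Relation.Unary.All as All
open import Data.List.Relation.Unary.AllPairs using (AllPairs; []; _∷_)
import Data.List.Relation.Unary.AllPairs as AllPairs
open import Data.Maybe using (Maybe; just; nothing)
import Data.Maybe as Maybe
open import Data.Product using (∃; _×_; _,_; proj₁; proj₂; swap)
open import Data.Sum using (inj₁; inj₂)
open import Function using (_∘_; case_of_; Equivalence)
open import Relation.Nullary using (¬_; yes; no; contradiction)
open import Relation.Binary.Definitions using (tri<; tri≈; tri>)
open import Relation.Binary.PropositionalEquality
  using (_≢_; refl; sym; trans; cong; subst; module ≡-Reasoning)

private
  variable
    n : ℕ

<ᵇ≡true⇒< : ∀ {m k} → (m <ᵇ k) ≡ true → m < k
<ᵇ≡true⇒< {m} {k} e = ℕ.<ᵇ⇒< m k (Equivalence.from T-≡ e)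

<⇒<ᵇ≡true : ∀ {m k} → m < k → (m <ᵇ k) ≡ true
<⇒<ᵇ≡true = Equivalence.to T-≡ ∘ ℕ.<⇒<ᵇ

<ᵇ≡false⇒≮ : ∀ {m k} → (m <ᵇ k) ≡ false → ¬ m < k
<ᵇ≡false⇒≮ e = not-¬ e ∘ <⇒<ᵇ≡true

≮⇒<ᵇ≡false : ∀ {m k} → ¬ m < k → (m <ᵇ k) ≡ false
≮⇒<ᵇ≡false m≮k = ¬-not (m≮k ∘ <ᵇ≡true⇒<)

reverse-∷-++ : ∀ {A : Set} (x : A) xs ys → reverse (x ∷ xs) ++ ys ≡ reverse xs ++ (x ∷ ys)
reverse-∷-++ x xs ys = trans (sym (ʳ++-defn (x ∷ xs))) (ʳ++-defn xs)

allB≡true⁻ : ∀ {A : Set} {q : A → Bool} {xs x} → allB q xs ≡ true → x ∈ˡ xs → q x ≡ true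
allB≡true⁻ {q = q} {x ∷ _} e (here refl) with q x
... | true = refl
allB≡true⁻ {q = q} {y ∷ _} e (there x∈xs) with q y
... | true = allB≡true⁻ e x∈xs

allB≡true⁺ : ∀ {A : Set} (q : A → Bool) xs → (∀ {x} → x ∈ˡ xs → q x ≡ true) → allB q xs ≡ true
allB≡true⁺ q []       all = refl
allB≡true⁺ q (x ∷ xs) all rewrite all (here refl) = allB≡true⁺ q xs (all ∘ there)

Disjoint-sym : {A B : Subset n} → Disjoint A B → Disjoint B A
Disjoint-sym {A = A} {B} A∩B=∅ (x , x∈B∩A) = A∩B=∅ (x , x∈p∩q⁺ (swap (x∈p∩q⁻ B A x∈B∩A)))

Disjoint⇒∉ : {A B : Subset n} {x : Fin n} → Disjoint A B → x ∈ A → x ∉ B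
Disjoint⇒∉ A∩B=∅ x∈A x∈B = A∩B=∅ (_ , x∈p∩q⁺ (x∈A , x∈B))

Disjoint⇒∉-Any : {A : Subset n} {x : Fin n} (Bs : List (Subset n)) →
                 All (Disjoint A) Bs → x ∈ A → ¬ Any (x ∈_) Bs
Disjoint⇒∉-Any (B ∷ Bs) (A∩B=∅ ∷ _) x∈A (here x∈B)   = Disjoint⇒∉ A∩B=∅ x∈A x∈B
Disjoint⇒∉-Any (B ∷ Bs) (_ ∷ disj)  x∈A (there x∈Bs) = Disjoint⇒∉-Any Bs disj x∈A x∈Bs

x∈p─q⇒x∉q : {x : Fin n} (p q : Subset n) → x ∈ p ─ q → x ∉ q
x∈p─q⇒x∉q (inside ∷ p) (outside ∷ q) here       ()
x∈p─q⇒x∉q (s ∷ p)      (t ∷ q)       (there x∈) (there x∈q) = x∈p─q⇒x∉q p q x∈ x∈q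

x∈p-y⇒x≢y : {x y : Fin n} (p : Subset n) → x ∈ p - y → x ≢ y
x∈p-y⇒x≢y {y = y} p x∈ refl = x∈p─q⇒x∉q p ⁅ y ⁆ x∈ (x∈⁅x⁆ y)

⁅x⁆∪[p-x]≡p : {x : Fin n} {p : Subset n} → x ∈ p → ⁅ x ⁆ ∪ (p - x) ≡ p
⁅x⁆∪[p-x]≡p {x = x} {p} x∈p = ⊆-antisym ⊆p p⊆
  where
  ⊆p : ∀ {y} → y ∈ ⁅ x ⁆ ∪ (p - x) → y ∈ p
  ⊆p y∈ with x∈p∪q⁻ ⁅ x ⁆ (p - x) y∈
  ... | inj₁ y∈⁅x⁆ rewrite x∈⁅y⁆⇒x≡y x y∈⁅x⁆ = x∈p
  ... | inj₂ y∈p-x = p─q⊆p p ⁅ x ⁆ y∈p-x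
  p⊆ : ∀ {y} → y ∈ p → y ∈ ⁅ x ⁆ ∪ (p - x)
  p⊆ {y} y∈p with y ≟ x
  ... | yes refl = x∈p∪q⁺ (inj₁ (x∈⁅x⁆ x))
  ... | no y≢x   = x∈p∪q⁺ (inj₂ (x∈p∧x≢y⇒x∈p-y y∈p y≢x))

[⁅x⁆∪p]-x≡p : {x : Fin n} {p : Subset n} → x ∉ p → (⁅ x ⁆ ∪ p) - x ≡ p
[⁅x⁆∪p]-x≡p {x = x} {p} x∉p = ⊆-antisym ⊆p p⊆
  where
  ⊆p : ∀ {y} → y ∈ (⁅ x ⁆ ∪ p) - x → y ∈ p
  ⊆p y∈ with x∈p∪q⁻ ⁅ x ⁆ p (p─q⊆p _ ⁅ x ⁆ y∈)
  ... | inj₁ y∈⁅x⁆ = contradiction (x∈⁅y⁆⇒x≡y x y∈⁅x⁆) (x∈p-y⇒x≢y _ y∈)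
  ... | inj₂ y∈p   = y∈p
  p⊆ : ∀ {y} → y ∈ p → y ∈ (⁅ x ⁆ ∪ p) - x
  p⊆ y∈p = x∈p∧x≢y⇒x∈p-y (x∈p∪q⁺ (inj₂ y∈p)) λ { refl → x∉p y∈p }

∈-elems⁻ : {x : Fin n} (p : Subset n) → x ∈ˡ elems p → x ∈ p
∈-elems⁻ (inside ∷ p)  (here refl) = here
∈-elems⁻ (inside ∷ p)  (there x∈)  with ∈-map⁻ Fin.suc x∈
... | y , y∈ , refl = there (∈-elems⁻ p y∈)
∈-elems⁻ (outside ∷ p) x∈          with ∈-map⁻ Fin.suc x∈
... | y , y∈ , refl = there (∈-elems⁻ p y∈)

∈-elems⁺ : {x : Fin n} (p : Subset n) → x ∈ p → x ∈ˡ elems p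
∈-elems⁺ (inside ∷ p)  here       = here refl
∈-elems⁺ (inside ∷ p)  (there x∈) = there (∈-map⁺ Fin.suc (∈-elems⁺ p x∈))
∈-elems⁺ (outside ∷ p) (there x∈) = ∈-map⁺ Fin.suc (∈-elems⁺ p x∈)

elems-⊥ : elems (⊥ {n}) ≡ []
elems-⊥ {zero}  = refl
elems-⊥ {suc n} rewrite elems-⊥ {n} = refl

elems-⁅x⁆ : (x : Fin n) → elems ⁅ x ⁆ ≡ x ∷ []
elems-⁅x⁆ {suc n} Fin.zero    rewrite elems-⊥ {n} = refl
elems-⁅x⁆         (Fin.suc x) rewrite elems-⁅x⁆ x = refl

elems≡[x]⇒≡⁅x⁆ : {x : Fin n} (p : Subset n) → elems p ≡ x ∷ [] → p ≡ ⁅ x ⁆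
elems≡[x]⇒≡⁅x⁆ {x = x} p e = ⊆-antisym ⊆⁅x⁆ ⁅x⁆⊆
  where
  ⊆⁅x⁆ : ∀ {y} → y ∈ p → y ∈ ⁅ x ⁆
  ⊆⁅x⁆ y∈p with subst (_ ∈ˡ_) e (∈-elems⁺ p y∈p)
  ... | here refl = x∈⁅x⁆ x
  ⁅x⁆⊆ : ∀ {y} → y ∈ ⁅ x ⁆ → y ∈ p
  ⁅x⁆⊆ y∈ rewrite x∈⁅y⁆⇒x≡y x y∈ = ∈-elems⁻ p (subst (x ∈ˡ_) (sym e) (here refl))

elems[p-x]≡[]⇒p≡⁅x⁆ : {x : Fin n} (p : Subset n) → x ∈ p → elems (p - x) ≡ [] → p ≡ ⁅ x ⁆
elems[p-x]≡[]⇒p≡⁅x⁆ {x = x} p x∈p e = ⊆-antisym ⊆⁅x⁆ ⁅x⁆⊆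
  where
  ⊆⁅x⁆ : ∀ {y} → y ∈ p → y ∈ ⁅ x ⁆
  ⊆⁅x⁆ {y} y∈p with y ≟ x
  ... | yes refl = x∈⁅x⁆ x
  ... | no y≢x with subst (y ∈ˡ_) e (∈-elems⁺ (p - x) (x∈p∧x≢y⇒x∈p-y y∈p y≢x))
  ... | ()
  ⁅x⁆⊆ : ∀ {y} → y ∈ ⁅ x ⁆ → y ∈ p
  ⁅x⁆⊆ y∈ rewrite x∈⁅y⁆⇒x≡y x y∈ = x∈p

minS≡just⇒minimum : (p : Subset n) {m : Fin n} → minS p ≡ just m →
                    m ∈ p × (∀ {x} → x ∈ p → toℕ m ≤ toℕ x)
minS≡just⇒minimum (inside ∷ p)  refl = here , λ _ → z≤n
minS≡just⇒minimum (outside ∷ p) e with minS p in eq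
minS≡just⇒minimum (outside ∷ p) refl | just m with minS≡just⇒minimum p eq
... | m∈p , min = there m∈p , λ { (there x∈p) → s≤s (min x∈p) }

minS≡nothing⇒∉ : (p : Subset n) {x : Fin n} → minS p ≡ nothing → x ∉ p
minS≡nothing⇒∉ (outside ∷ p) e (there x∈p) with minS p in eq
minS≡nothing⇒∉ (outside ∷ p) refl (there x∈p) | nothing = minS≡nothing⇒∉ p eq x∈p

minS-⊥ : minS (⊥ {n}) ≡ nothing
minS-⊥ {zero}  = refl
minS-⊥ {suc n} rewrite minS-⊥ {n} = refl

mLess-minS⁺ : (p : Subset n) {x d : Fin n} → x ∈ p → toℕ x < toℕ d → mLess (minS p) d ≡ true
mLess-minS⁺ p x∈p x<d with minS p in e
... | just m  = <⇒<ᵇ≡true (ℕ.≤-<-trans (proj₂ (minS≡just⇒minimum p e) x∈p) x<d)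
... | nothing = contradiction x∈p (minS≡nothing⇒∉ p e)

mLess-minS⁻ : (p : Subset n) {d : Fin n} → mLess (minS p) d ≡ true → ∃ λ x → x ∈ p × toℕ x < toℕ d
mLess-minS⁻ p m<d with minS p in e
... | just m = m , proj₁ (minS≡just⇒minimum p e) , <ᵇ≡true⇒< m<d

mGreater⇒¬mLess : (m : Maybe (Fin n)) {d : Fin n} → mGreater m d ≡ true → mLess m d ≡ false
mGreater⇒¬mLess nothing  _   = refl
mGreater⇒¬mLess (just m) {d} d<m = ≮⇒<ᵇ≡false (ℕ.<-asym (<ᵇ≡true⇒< {toℕ d} d<m))

mGreater-minS⁻ : (p : Subset n) {x d : Fin n} → x ∈ p → toℕ x < toℕ d → mGreater (minS p) d ≡ false
mGreater-minS⁻ p x∈p x<d =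
  ¬-not λ m>d → not-¬ (mLess-minS⁺ p x∈p x<d) (mGreater⇒¬mLess (minS p) m>d)

-- When d ∉ p, the minimum of p cannot equal d, so exactly one of m < d and m > d holds.
¬mLess⇒mGreater : (p : Subset n) {d : Fin n} → d ∉ p →
                  mLess (minS p) d ≡ false → mGreater (minS p) d ≡ true
¬mLess⇒mGreater p {d} d∉p m≮d with minS p in e
... | nothing = refl
... | just m  = <⇒<ᵇ≡true (ℕ.≤∧≢⇒< (ℕ.≮⇒≥ (<ᵇ≡false⇒≮ m≮d)) d≢m)
  where
  d≢m : toℕ d ≢ toℕ m
  d≢m d≡m = d∉p (subst (_∈ p) (sym (Fin.toℕ-injective d≡m)) (proj₁ (minS≡just⇒minimum p e)))

¬mGreater⇒mLess : (p : Subset n) {d : Fin n} → d ∉ p →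
                  mGreater (minS p) d ≡ false → mLess (minS p) d ≡ true
¬mGreater⇒mLess p d∉p m≯d =
  ¬-not λ m≮d → not-¬ m≯d (¬mLess⇒mGreater p d∉p m≮d)

record LeastWith (q : Fin n → Bool) (p : Subset n) (c : Fin n) : Set where
  field
    member  : c ∈ p
    holds   : q c ≡ true
    earlier : ∀ {y} → y ∈ p → toℕ y < toℕ c → q y ≡ false

firstWith-map : ∀ {A B : Set} (q : B → Bool) (f : A → B) xs →
                firstWith q (map f xs) ≡ Maybe.map f (firstWith (q ∘ f) xs)
firstWith-map q f []       = refl
firstWith-map q f (x ∷ xs) with q (f x)
... | true  = refl
... | false = firstWith-map q f xs

LeastWith-there : {q : Fin (suc n) → Bool} {s : Side} {p : Subset n} {c : Fin n} →
                  (s ≡ inside → q Fin.zero ≡ false) →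
                  LeastWith (q ∘ Fin.suc) p c → LeastWith q (s ∷ p) (Fin.suc c)
LeastWith-there {s = s} q0 least = record
  { member  = there member
  ; holds   = holds
  ; earlier = λ { {Fin.zero} here _ → q0 refl ; {Fin.suc y} (there y∈) (s≤s y<c) → earlier y∈ y<c }
  }
  where open LeastWith least

LeastWith-unthere : {q : Fin (suc n) → Bool} {s : Side} {p : Subset n} {c : Fin n} →
                    LeastWith q (s ∷ p) (Fin.suc c) → LeastWith (q ∘ Fin.suc) p c
LeastWith-unthere least = record
  { member  = case member of λ { (there c∈) → c∈ }
  ; holds   = holds
  ; earlier = λ y∈ y<c → earlier (there y∈) (s≤s y<c)
  }
  where open LeastWith least

firstWith-elems⁻ : (q : Fin n → Bool) (p : Subset n) {c : Fin n} →
                   firstWith q (elems p) ≡ just c → LeastWith q p c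
firstWith-elems⁻ q (inside ∷ p) e with q Fin.zero in q0
firstWith-elems⁻ q (inside ∷ p) refl | true =
  record { member = here ; holds = q0 ; earlier = λ _ () }
... | false rewrite firstWith-map q Fin.suc (elems p) with firstWith (q ∘ Fin.suc) (elems p) in e′
firstWith-elems⁻ q (inside ∷ p) refl | false | just c =
  LeastWith-there (λ _ → q0) (firstWith-elems⁻ (q ∘ Fin.suc) p e′)
firstWith-elems⁻ q (outside ∷ p) e rewrite firstWith-map q Fin.suc (elems p)
  with firstWith (q ∘ Fin.suc) (elems p) in e′
firstWith-elems⁻ q (outside ∷ p) refl | just c =
  LeastWith-there (λ ()) (firstWith-elems⁻ (q ∘ Fin.suc) p e′)

firstWith-elems⁺ : (q : Fin n → Bool) (p : Subset n) {c : Fin n} →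
                   LeastWith q p c → firstWith q (elems p) ≡ just c
firstWith-elems⁺ q (s ∷ p) {Fin.zero} least with LeastWith.member least
... | here rewrite LeastWith.holds least = refl
firstWith-elems⁺ q (inside ∷ p) {Fin.suc c} least
  rewrite LeastWith.earlier least here (s≤s z≤n) | firstWith-map q Fin.suc (elems p)
        | firstWith-elems⁺ (q ∘ Fin.suc) p (LeastWith-unthere least) = refl
firstWith-elems⁺ q (outside ∷ p) {Fin.suc c} least
  rewrite firstWith-map q Fin.suc (elems p)
        | firstWith-elems⁺ (q ∘ Fin.suc) p (LeastWith-unthere least) = refl

anyFin-⊥ : (f : Fin n → Bool) → anyFin (λ v → isIn v ⊥ ∧ f v) ≡ false
anyFin-⊥ {zero}  f = refl
anyFin-⊥ {suc n} f = anyFin-⊥ (f ∘ Fin.suc)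

anyFin-⁅x⁆ : (f : Fin n → Bool) (x : Fin n) → anyFin (λ v → isIn v ⁅ x ⁆ ∧ f v) ≡ f x
anyFin-⁅x⁆ f Fin.zero    = trans (cong (f Fin.zero ∨_) (anyFin-⊥ (f ∘ Fin.suc))) (∨-identityʳ (f Fin.zero))
anyFin-⁅x⁆ f (Fin.suc x) = anyFin-⁅x⁆ (f ∘ Fin.suc) x

module _ (G : SimpleGraph n) where

  hasNbr-⁅x⁆ : (c x : Fin n) → hasNbr G c ⁅ x ⁆ ≡ adj G c x
  hasNbr-⁅x⁆ c = anyFin-⁅x⁆ (adj G c)

  mc< mc> : List (Subset n) → Fin n → Bool
  mc< pre c = mLess (mc G c pre) c
  mc> pre c = mGreater (mc G c pre) c

  DR-∷-nonadjacent : (c : Fin n) (Q : Subset n) (pre : List (Subset n)) →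
                     hasNbr G c Q ≡ false → DR G c (Q ∷ pre) ≡ Q ∪ DR G c pre
  DR-∷-nonadjacent c Q pre h rewrite h = refl

  ∈DR⇒∈-Any : {x : Fin n} (c : Fin n) (pre : List (Subset n)) → x ∈ DR G c pre → Any (x ∈_) pre
  ∈DR⇒∈-Any c []        x∈ = contradiction x∈ ∉⊥
  ∈DR⇒∈-Any c (Q ∷ pre) x∈ with hasNbr G c Q
  ... | true  = contradiction x∈ ∉⊥
  ... | false with x∈p∪q⁻ Q (DR G c pre) x∈
  ...   | inj₁ x∈Q  = here x∈Q
  ...   | inj₂ x∈DR = there (∈DR⇒∈-Any c pre x∈DR)

  mc<⇒¬hasNbr : (c : Fin n) (Q : Subset n) (pre : List (Subset n)) →
                mc< (Q ∷ pre) c ≡ true → hasNbr G c Q ≡ false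
  mc<⇒¬hasNbr c Q pre m<c with hasNbr G c Q
  ... | false = refl
  ... | true rewrite minS-⊥ {n} with m<c
  ...   | ()

  isBad-⁅⁆ : (pre : List (Subset n)) (S : Subset n) {c : Fin n} → elems S ≡ c ∷ [] →
             isBad G pre S ≡ mc< pre c
  isBad-⁅⁆ pre S e with elems S
  isBad-⁅⁆ pre S refl | _ = refl

  isBad-two : (pre : List (Subset n)) (S : Subset n) {x y : Fin n} →
              x ∈ S → y ∈ S → x ≢ y → isBad G pre S ≡ true
  isBad-two pre S x∈S y∈S x≢y with elems S | ∈-elems⁺ S x∈S | ∈-elems⁺ S y∈S
  ... | _ ∷ []    | here refl | here refl = contradiction refl x≢y
  ... | _ ∷ _ ∷ _ | _         | _         = refl

  isBad-all-mc< : (pre : List (Subset n)) (S : Subset n) → elems S ≢ [] →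
                  (∀ {d} → d ∈ S → mc< pre d ≡ true) → isBad G pre S ≡ true
  isBad-all-mc< pre S elems≢[] all with elems S in e
  ... | []        = contradiction refl elems≢[]
  ... | d ∷ []    = all (∈-elems⁻ S (subst (d ∈ˡ_) (sym e) (here refl)))
  ... | _ ∷ _ ∷ _ = refl

  ¬isBad⇒elems≡[p] : (pre : List (Subset n)) (P : Subset n) → isBad G pre P ≡ false → Nonempty P →
                     ∃ λ p → elems P ≡ p ∷ []
  ¬isBad⇒elems≡[p] pre P good (x , x∈P) with elems P in e | ∈-elems⁺ P x∈P
  ... | p ∷ []    | _ = p , refl
  ... | _ ∷ _ ∷ _ | _ = contradiction good λ ()

  φ-go-good : ∀ pre B rest → isBad G pre B ≡ false → φ-go G pre (B ∷ rest) ≡ φ-go G (B ∷ pre) rest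
  φ-go-good pre B rest good rewrite good = refl

  φ-go-merge : ∀ P pre B rest → isBad G (P ∷ pre) B ≡ true → allB (mc< (P ∷ pre)) (elems B) ≡ true →
               φ-go G (P ∷ pre) (B ∷ rest) ≡ reverse pre ++ ((P ∪ B) ∷ rest)
  φ-go-merge P pre B rest bad all< rewrite bad | all< = refl

  φ-go-merge-[] : ∀ B rest → isBad G [] B ≡ true → allB (mc< []) (elems B) ≡ true →
                  φ-go G [] (B ∷ rest) ≡ B ∷ rest
  φ-go-merge-[] B rest bad all< rewrite bad | all< = refl

  φ-go-split : ∀ pre B rest {c} → isBad G pre B ≡ true → allB (mc< pre) (elems B) ≡ false →
               firstWith (mc> pre) (elems B) ≡ just c →
               φ-go G pre (B ∷ rest) ≡ reverse pre ++ (⁅ c ⁆ ∷ (B - c) ∷ rest)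
  φ-go-split pre B rest bad ¬all< first> rewrite bad | ¬all< | first> = refl

  φ-go-split-nothing : ∀ pre B rest → isBad G pre B ≡ true → allB (mc< pre) (elems B) ≡ false →
                       firstWith (mc> pre) (elems B) ≡ nothing →
                       φ-go G pre (B ∷ rest) ≡ reverse pre ++ (B ∷ rest)
  φ-go-split-nothing pre B rest bad ¬all< first> rewrite bad | ¬all< | first> = refl

  data Good : List (Subset n) → Set where
    []  : Good []
    _∷_ : ∀ {B pre} → isBad G pre B ≡ false → Good pre → Good (B ∷ pre)

  φ-replay : ∀ {pre} → Good pre → ∀ rest → φ G (reverse pre ++ rest) ≡ φ-go G pre rest
  φ-replay []                      rest = refl
  φ-replay (_∷_ {B} {pre} good gs) rest = begin
    φ G (reverse (B ∷ pre) ++ rest)  ≡⟨ cong (φ G) (reverse-∷-++ B pre rest) ⟩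
    φ G (reverse pre ++ (B ∷ rest))  ≡⟨ φ-replay gs (B ∷ rest) ⟩
    φ-go G pre (B ∷ rest)            ≡⟨ φ-go-good pre B rest good ⟩
    φ-go G (B ∷ pre) rest            ∎
    where open ≡-Reasoning

  φ-involutive-fixed : ∀ {pre} → Good pre → ∀ L → φ-go G pre L ≡ reverse pre ++ L →
                       φ G (φ-go G pre L) ≡ reverse pre ++ L
  φ-involutive-fixed {pre} good L fixed = begin
    φ G (φ-go G pre L)       ≡⟨ cong (φ G) fixed ⟩
    φ G (reverse pre ++ L)   ≡⟨ φ-replay good L ⟩
    φ-go G pre L             ≡⟨ fixed ⟩
    reverse pre ++ L         ∎
    where open ≡-Reasoning

  data Action (pre : List (Subset n)) (B : Subset n) : Set where
    pass  : isBad G pre B ≡ false → Action pre B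
    merge : isBad G pre B ≡ true → allB (mc< pre) (elems B) ≡ true → Action pre B
    split : ∀ {c} → isBad G pre B ≡ true → allB (mc< pre) (elems B) ≡ false →
            firstWith (mc> pre) (elems B) ≡ just c → Action pre B
    stuck : isBad G pre B ≡ true → allB (mc< pre) (elems B) ≡ false →
            firstWith (mc> pre) (elems B) ≡ nothing → Action pre B

  action : ∀ pre B → Action pre B
  action pre B with isBad G pre B in bad
  ... | false = pass bad
  ... | true with allB (mc< pre) (elems B) in all<
  ...   | true  = merge bad all<
  ...   | false with firstWith (mc> pre) (elems B) in first>
  ...     | just c  = split bad all< first>
  ...     | nothing = stuck bad all< first>

  record Blocks (pre L : List (Subset n)) : Set where
    field
      nonempty-pre   : All Nonempty pre
      disjoint-pre   : AllPairs Disjoint pre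
      nonempty       : All Nonempty L
      independent    : All (Independent G) L
      disjoint       : AllPairs Disjoint L
      disjoint-cross : All (λ B → All (Disjoint B) pre) L

  Blocks-[] : ∀ {L} → IsMill G L → Blocks [] L
  Blocks-[] {L} (nonempty , independent , disjoint , _) = record
    { nonempty-pre = [] ; disjoint-pre = [] ; nonempty = nonempty ; independent = independent
    ; disjoint = disjoint ; disjoint-cross = All.tabulate (λ _ → []) }

  Blocks-step : ∀ {pre B rest} → Blocks pre (B ∷ rest) → Blocks (B ∷ pre) rest
  Blocks-step blocks = record
    { nonempty-pre   = All.head nonempty ∷ nonempty-pre
    ; disjoint-pre   = All.head disjoint-cross ∷ disjoint-pre
    ; nonempty       = All.tail nonempty
    ; independent    = All.tail independent
    ; disjoint       = AllPairs.tail disjoint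
    ; disjoint-cross = All.zipWith (λ (B∩R=∅ , Rs) → Disjoint-sym B∩R=∅ ∷ Rs)
                                   (AllPairs.head disjoint , All.tail disjoint-cross)
    }
    where open Blocks blocks

  mc<-∷-nonadjacent : ∀ {d Q} pre → hasNbr G d Q ≡ false →
                      mc< (Q ∷ pre) d ≡ mLess (minS (Q ∪ DR G d pre)) d
  mc<-∷-nonadjacent {d} {Q} pre h = cong (λ X → mLess (minS X) d) (DR-∷-nonadjacent d Q pre h)

  ∉DR : ∀ {B d} pre → All (Disjoint B) pre → d ∈ B → d ∉ DR G d pre
  ∉DR pre disj d∈B = Disjoint⇒∉-Any pre disj d∈B ∘ ∈DR⇒∈-Any _ pre

  φ-involutive-split : ∀ {pre B rest c} → Good pre → Blocks pre (B ∷ rest) →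
                       isBad G pre B ≡ true → allB (mc< pre) (elems B) ≡ false →
                       firstWith (mc> pre) (elems B) ≡ just c →
                       φ G (φ-go G pre (B ∷ rest)) ≡ reverse pre ++ (B ∷ rest)
  φ-involutive-split {pre} {B} {rest} {c} good blocks bad ¬all< first> = begin
    φ G (φ-go G pre (B ∷ rest))
      ≡⟨ cong (φ G) (φ-go-split pre B rest bad ¬all< first>) ⟩
    φ G (reverse pre ++ (⁅ c ⁆ ∷ (B - c) ∷ rest))
      ≡⟨ φ-replay good _ ⟩
    φ-go G pre (⁅ c ⁆ ∷ (B - c) ∷ rest)
      ≡⟨ φ-go-good pre ⁅ c ⁆ _ ⁅c⁆-good ⟩
    φ-go G (⁅ c ⁆ ∷ pre) ((B - c) ∷ rest)
      ≡⟨ φ-go-merge ⁅ c ⁆ pre (B - c) rest B-c-bad all<′ ⟩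
    reverse pre ++ ((⁅ c ⁆ ∪ (B - c)) ∷ rest)
      ≡⟨ cong (λ C → reverse pre ++ (C ∷ rest)) (⁅x⁆∪[p-x]≡p c∈B) ⟩
    reverse pre ++ (B ∷ rest)
      ∎
    where
    open ≡-Reasoning
    open Blocks blocks
    open LeastWith (firstWith-elems⁻ (mc> pre) B first>) renaming (member to c∈B)

    ⁅c⁆-good : isBad G pre ⁅ c ⁆ ≡ false
    ⁅c⁆-good = trans (isBad-⁅⁆ pre ⁅ c ⁆ (elems-⁅x⁆ c)) (mGreater⇒¬mLess (mc G c pre) holds)

    mc<-after-c : ∀ {d} → d ∈ B - c → mc< (⁅ c ⁆ ∷ pre) d ≡ true
    mc<-after-c {d} d∈B-c = trans (mc<-∷-nonadjacent pre c≁d) m<d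
      where
      d∈B = p─q⊆p B ⁅ c ⁆ d∈B-c
      c≁d = trans (hasNbr-⁅x⁆ d c) (All.head independent d c d∈B c∈B)
      m<d : mLess (minS (⁅ c ⁆ ∪ DR G d pre)) d ≡ true
      m<d with ℕ.<-cmp (toℕ c) (toℕ d)
      ... | tri< c<d _ _ = mLess-minS⁺ (⁅ c ⁆ ∪ DR G d pre) (x∈p∪q⁺ (inj₁ (x∈⁅x⁆ c))) c<d
      ... | tri≈ _ c≡d _ = contradiction (sym (Fin.toℕ-injective c≡d)) (x∈p-y⇒x≢y B d∈B-c)
      ... | tri> _ _ d<c
        with mLess-minS⁻ (DR G d pre)
               (¬mGreater⇒mLess (DR G d pre) (∉DR pre (All.head disjoint-cross) d∈B) (earlier d∈B d<c))
      ...   | x , x∈DR , x<d = mLess-minS⁺ (⁅ c ⁆ ∪ DR G d pre) (x∈p∪q⁺ (inj₂ x∈DR)) x<d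

    B-c-bad : isBad G (⁅ c ⁆ ∷ pre) (B - c) ≡ true
    B-c-bad = isBad-all-mc< _ (B - c) elems≢[] mc<-after-c
      where
      elems≢[] : elems (B - c) ≢ []
      elems≢[] e = contradiction (trans (sym ⁅c⁆-bad) ⁅c⁆-good) λ ()
        where ⁅c⁆-bad = subst (λ S → isBad G pre S ≡ true) (elems[p-x]≡[]⇒p≡⁅x⁆ B c∈B e) bad

    all<′ : allB (mc< (⁅ c ⁆ ∷ pre)) (elems (B - c)) ≡ true
    all<′ = allB≡true⁺ _ _ (mc<-after-c ∘ ∈-elems⁻ (B - c))

  φ-involutive-merge : ∀ {P pre B rest} → Good (P ∷ pre) → Blocks (P ∷ pre) (B ∷ rest) →
                       isBad G (P ∷ pre) B ≡ true → allB (mc< (P ∷ pre)) (elems B) ≡ true →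
                       φ G (φ-go G (P ∷ pre) (B ∷ rest)) ≡ reverse (P ∷ pre) ++ (B ∷ rest)
  φ-involutive-merge {P} {pre} {B} {rest} (P-good ∷ good) blocks bad all<
    with ¬isBad⇒elems≡[p] pre P P-good (All.head (Blocks.nonempty-pre blocks))
  ... | p , elemsP≡[p] with elems≡[x]⇒≡⁅x⁆ P elemsP≡[p]
  ... | refl = begin
    φ G (φ-go G (⁅ p ⁆ ∷ pre) (B ∷ rest))
      ≡⟨ cong (φ G) (φ-go-merge ⁅ p ⁆ pre B rest bad all<) ⟩
    φ G (reverse pre ++ ((⁅ p ⁆ ∪ B) ∷ rest))
      ≡⟨ φ-replay good _ ⟩
    φ-go G pre ((⁅ p ⁆ ∪ B) ∷ rest)
      ≡⟨ φ-go-split pre (⁅ p ⁆ ∪ B) rest ⁅p⁆∪B-bad ¬all< first> ⟩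
    reverse pre ++ (⁅ p ⁆ ∷ ((⁅ p ⁆ ∪ B) - p) ∷ rest)
      ≡⟨ cong (λ C → reverse pre ++ (⁅ p ⁆ ∷ C ∷ rest)) ([⁅x⁆∪p]-x≡p p∉B) ⟩
    reverse pre ++ (⁅ p ⁆ ∷ B ∷ rest)
      ≡⟨ reverse-∷-++ ⁅ p ⁆ pre (B ∷ rest) ⟨
    reverse (⁅ p ⁆ ∷ pre) ++ (B ∷ rest)
      ∎
    where
    open ≡-Reasoning
    open Blocks blocks

    p∈⁅p⁆∪B : p ∈ ⁅ p ⁆ ∪ B
    p∈⁅p⁆∪B = x∈p∪q⁺ (inj₁ (x∈⁅x⁆ p))

    p∉B : p ∉ B
    p∉B = Disjoint⇒∉ (Disjoint-sym (All.head (All.head disjoint-cross))) (x∈⁅x⁆ p)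

    ⁅p⁆∪B-bad : isBad G pre (⁅ p ⁆ ∪ B) ≡ true
    ⁅p⁆∪B-bad with All.head nonempty
    ... | b , b∈B = isBad-two pre (⁅ p ⁆ ∪ B) p∈⁅p⁆∪B (x∈p∪q⁺ (inj₂ b∈B)) λ { refl → p∉B b∈B }

    p-not-mc< : mc< pre p ≡ false
    p-not-mc< = trans (sym (isBad-⁅⁆ pre ⁅ p ⁆ elemsP≡[p])) P-good

    ¬all< : allB (mc< pre) (elems (⁅ p ⁆ ∪ B)) ≡ false
    ¬all< = ¬-not λ all< → not-¬ p-not-mc< (allB≡true⁻ all< (∈-elems⁺ _ p∈⁅p⁆∪B))

    -- y's disconnected region contains p, so m_y < y after {p} is inherited from pre when y < p.
    earlier : ∀ {y} → y ∈ ⁅ p ⁆ ∪ B → toℕ y < toℕ p → mc> pre y ≡ false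
    earlier {y} y∈ y<p with x∈p∪q⁻ ⁅ p ⁆ B y∈
    ... | inj₁ y∈⁅p⁆ rewrite x∈⁅y⁆⇒x≡y p y∈⁅p⁆ = contradiction y<p (ℕ.<-irrefl refl)
    ... | inj₂ y∈B
      with mLess-minS⁻ (⁅ p ⁆ ∪ DR G y pre)
             (trans (sym (mc<-∷-nonadjacent pre (mc<⇒¬hasNbr y ⁅ p ⁆ pre m<y))) m<y)
      where m<y = allB≡true⁻ all< (∈-elems⁺ B y∈B)
    ...   | x , x∈ , x<y with x∈p∪q⁻ ⁅ p ⁆ (DR G y pre) x∈
    ...     | inj₁ x∈⁅p⁆ rewrite x∈⁅y⁆⇒x≡y p x∈⁅p⁆ = contradiction x<y (ℕ.<-asym y<p)
    ...     | inj₂ x∈DR = mGreater-minS⁻ (DR G y pre) x∈DR x<y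

    first> : firstWith (mc> pre) (elems (⁅ p ⁆ ∪ B)) ≡ just p
    first> = firstWith-elems⁺ (mc> pre) (⁅ p ⁆ ∪ B) record
      { member  = p∈⁅p⁆∪B
      ; holds   = ¬mLess⇒mGreater (DR G p pre) (∉DR pre (AllPairs.head disjoint-pre) (x∈⁅x⁆ p)) p-not-mc<
      ; earlier = earlier
      }

  φ-go-involutive : ∀ {pre} → Good pre → ∀ L → Blocks pre L → φ G (φ-go G pre L) ≡ reverse pre ++ L
  φ-go-involutive {pre} good [] _ = φ-involutive-fixed good [] (sym (++-identityʳ (reverse pre)))
  φ-go-involutive {pre} good (B ∷ rest) blocks with action pre B
  ... | pass good-B = begin
    φ G (φ-go G pre (B ∷ rest))  ≡⟨ cong (φ G) (φ-go-good pre B rest good-B) ⟩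
    φ G (φ-go G (B ∷ pre) rest)  ≡⟨ φ-go-involutive (good-B ∷ good) rest (Blocks-step blocks) ⟩
    reverse (B ∷ pre) ++ rest    ≡⟨ reverse-∷-++ B pre rest ⟩
    reverse pre ++ (B ∷ rest)    ∎
    where open ≡-Reasoning
  ... | split bad ¬all< first> = φ-involutive-split good blocks bad ¬all< first>
  -- stuck, and merge with nothing to the left, do not occur on Mill(G); φ-go is the identity there.
  ... | stuck bad ¬all< none   = φ-involutive-fixed good _ (φ-go-split-nothing pre B rest bad ¬all< none)
  φ-go-involutive {[]}    good (B ∷ rest) blocks | merge bad all< =
    φ-involutive-fixed good _ (φ-go-merge-[] B rest bad all<)
  φ-go-involutive {_ ∷ _} good (B ∷ rest) blocks | merge bad all< = φ-involutive-merge good blocks bad all<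

lemma3p14 : ∀ {n : ℕ} (G : SimpleGraph n) (L : List (Subset n)) → IsMill G L → φ G (φ G L) ≡ L
lemma3p14 G L mill = φ-go-involutive G [] L (Blocks-[] G mill)
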